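{- For any $n\geq 1$ and any even $b\geq 2$, the set $R_n(b)$ listed in co-Reflected Gray Code Order $\lessdot$ is a $3$-adjacent Gray code.
   Context: A restricted growth function of length $n$ is an integer sequence $s_1s_2\ldots s_n$ with $s_1=0$ and $0\leq s_{i+1}\leq \max\{s_j\}_{j=1}^i+1$ for all $1\leq i\leq n-1$; $R_n$ denotes the set of these. For an integer $b\geq 1$, $R_n(b)=\{s_1\ldots s_n\in R_n : \max_i s_i\leq b\}$. The co-Reflected Gray Code Order $\lessdot$ on $\{0,1,\ldots,m-1\}^n$ ($m\geq 2$) is defined by: $\mathbf{s}=s_1\ldots s_n \lessdot \mathbf{t}=t_1\ldots t_n$ if, for the leftmost position $k$ with $s_k\neq t_k$ (so $s_i=t_i$ for $i<k$), either $U_k$ is even and $s_k<t_k$, or $U_k$ is odd and $s_k>t_k$, where $U_k=|\{i\in\{1,\ldots,k-1\}: s_i\neq 0,\ s_i \text{ even}\}|$. A list of same-length sequences is a $d$-Gray code if consecutive sequences have Hamming distance at most $d$; it is a $d$-adjacent Gray code if, moreover, the positions where consecutive sequences differ are adjacent. -}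

module Defs where

open import Data.Nat using (ℕ; zero; suc; _+_; _≤_; _<_; _⊔_; _%_)
open import Data.Nat.Divisibility using (_∣_)
open import Data.Vec using (Vec; []; _∷_; lookup)
open import Data.Fin using (Fin; toℕ)
open import Data.Product using (_×_)
open import Data.Sum using (_⊎_)
open import Data.Unit using (⊤)
open import Data.Empty using (⊥)
open import Relation.Nullary using (¬_)
import Data.Nat
import Relation.Nullary
open import Relation.Binary.PropositionalEquality using (_≡_; _≢_)

RGTail : ℕ → {n : ℕ} → Vec ℕ n → Set
RGTail m [] = ⊤
RGTail m (x ∷ xs) = (x ≤ suc m) × RGTail (m ⊔ x) xs

IsRGF : {n : ℕ} → Vec ℕ n → Set
IsRGF [] = ⊤
IsRGF (x ∷ xs) = (x ≡ 0) × RGTail x xs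

BoundedBy : ℕ → {n : ℕ} → Vec ℕ n → Set
BoundedBy b [] = ⊤
BoundedBy b (x ∷ xs) = (x ≤ b) × BoundedBy b xs

InR : (n b : ℕ) → Vec ℕ n → Set
InR n b s = IsRGF s × BoundedBy b s

wt : ℕ → ℕ
wt zero = 0
wt (suc x) with suc x % 2
... | zero = 1
... | suc _ = 0

-- co-Reflected Gray Code Order; u = U_k counts nonzero even entries of the common prefix.
coLt : ℕ → {n : ℕ} → Vec ℕ n → Vec ℕ n → Set
coLt u [] [] = ⊥
coLt u (x ∷ xs) (y ∷ ys) =
  ((x ≡ y) × coLt (u + wt x) xs ys)
  ⊎ ((x ≢ y) × (((u % 2 ≡ 0) × (x < y)) ⊎ ((u % 2 ≡ 1) × (y < x))))

_⋖_ : {n : ℕ} → Vec ℕ n → Vec ℕ n → Set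
s ⋖ t = coLt 0 s t

hamming : {n : ℕ} → Vec ℕ n → Vec ℕ n → ℕ
hamming [] [] = 0
hamming (x ∷ xs) (y ∷ ys) with Data.Nat._≟_ x y
... | Relation.Nullary.yes _ = hamming xs ys
... | Relation.Nullary.no _ = suc (hamming xs ys)

DiffAdjacent : {n : ℕ} → Vec ℕ n → Vec ℕ n → Set
DiffAdjacent {n} s t = (i j k : Fin n) → toℕ i ≤ toℕ j → toℕ j ≤ toℕ k →
  lookup s i ≢ lookup t i → lookup s k ≢ lookup t k → lookup s j ≢ lookup t j

AdjGrayStep : ℕ → {n : ℕ} → Vec ℕ n → Vec ℕ n → Set
AdjGrayStep d s t = (hamming s t ≤ d) × DiffAdjacent s t

module Submission where

-- The counter U_k only matters through its parity, so the order is a lexicographic order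
-- whose direction (ascending/descending) is carried along as a Boolean and toggled by every
-- nonzero even entry (Lt, coLt⇒Lt); it is a strict order.  Fix the prefix maximum m of a
-- position and consider the valid tails that may follow it.  In each direction there is a
-- least tail (all zeros, or the largest allowed entry followed by the least tail it induces)
-- and, by reversing the direction, a greatest one.  Every tail below another has an immediate
-- successor: either the successor of its own tail, or, if that tail is greatest, the first
-- entry moves one step and the least tail follows (successor).  Since b is even, a least
-- descending tail is nonzero in at most two leading entries, which makes the greatest tail
-- before and the least tail after such a step differ in at most two leading entries
-- (boundary); so each successor step changes a run of at most 3 positions (Block 3).
-- Finally, consecutive members of the sorted list L = R_n(b) have nothing of L between them,
-- so each is the immediate successor of its predecessor (linked-gapFree).

open import Defs
open import Data.Nat using (ℕ; zero; suc; pred; _+_; _*_; _≤_; _<_; _⊔_; _⊓_; _%_; z≤n; s≤s; s≤s⁻¹; _≟_; _≤?_)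
open import Data.Nat.Properties
open import Data.Nat.Divisibility using (_∣_; divides)
open import Data.Bool using (Bool; true; false; not; _xor_; if_then_else_)
open import Data.Bool.Properties using (not-involutive; not-distribˡ-xor; xor-comm; xor-identityʳ)
open import Data.Vec using (Vec; []; _∷_; replicate; lookup)
open import Data.Fin using (Fin; toℕ) renaming (zero to fzero; suc to fsuc)
open import Data.List using (List; []; _∷_)
open import Data.List.Membership.Propositional using (_∈_)
open import Data.List.Relation.Unary.Any using (here; there)
open import Data.List.Relation.Unary.All as All using (_∷_)
open import Data.List.Relation.Unary.AllPairs using (AllPairs; _∷_)
open import Data.List.Relation.Unary.Linked as LinkedP using (Linked; []; [-]; _∷_)
open import Data.List.Relation.Unary.Linked.Properties using (Linked⇒AllPairs)
open import Data.Product using (_×_; _,_; Σ-syntax; proj₁; proj₂)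
open import Data.Sum using (_⊎_; inj₁; inj₂)
open import Data.Empty using (⊥; ⊥-elim)
open import Data.Unit using (tt)
open import Relation.Nullary using (¬_; yes; no; contradiction)
open import Relation.Binary.PropositionalEquality

-- Parity as a Boolean, and the entries that reverse the order of what follows them:
-- the nonzero even ones, i.e. those with wt x = 1.
odd : ℕ → Bool
odd zero = false
odd (suc n) = not (odd n)

flip : ℕ → Bool
flip zero = false
flip (suc n) = odd n

odd-%2 : ∀ u → u % 2 ≡ (if odd u then 1 else 0)
odd-%2 zero = refl
odd-%2 (suc zero) = refl
odd-%2 (suc (suc u)) rewrite not-involutive (odd u) = odd-%2 u

wt-flip : ∀ x → wt x ≡ (if flip x then 1 else 0)
wt-flip zero = refl
wt-flip (suc x) with odd x | suc x % 2 | odd-%2 (suc x)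
... | true  | zero  | _  = refl
... | true  | suc _ | ()
... | false | zero  | ()
... | false | suc _ | _  = refl

odd-+wt : ∀ u x → odd (u + wt x) ≡ odd u xor flip x
odd-+wt u x rewrite wt-flip x with flip x
... | true  = trans (cong odd (+-comm u 1)) (sym (xor-comm (odd u) true))
... | false = trans (cong odd (+-identityʳ u)) (sym (xor-identityʳ (odd u)))

-- Lexicographic order whose direction is tracked by a Boolean: at the first difference the
-- entries are compared ascending (false) or descending (true), and passing an entry x
-- toggles the direction iff flip x.
Dir : Bool → ℕ → ℕ → Set
Dir false x y = x < y
Dir true x y = y < x

Lt : Bool → ∀ {ℓ} → Vec ℕ ℓ → Vec ℕ ℓ → Set
Lt p [] [] = ⊥
Lt p (x ∷ xs) (y ∷ ys) = ((x ≡ y) × Lt (p xor flip x) xs ys) ⊎ Dir p x y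

Le : Bool → ∀ {ℓ} → Vec ℕ ℓ → Vec ℕ ℓ → Set
Le p s t = s ≡ t ⊎ Lt p s t

Le-cons : ∀ {p x ℓ} {xs ys : Vec ℕ ℓ} → Le (p xor flip x) xs ys → Le p (x ∷ xs) (x ∷ ys)
Le-cons (inj₁ refl) = inj₁ refl
Le-cons (inj₂ l) = inj₂ (inj₁ (refl , l))

-- The co-reflected Gray code order with counter u is the directed order with direction
-- "u is odd": the counter only matters through its parity, which flip x updates.
coLt⇒Lt : ∀ u {ℓ} (s t : Vec ℕ ℓ) → coLt u s t → Lt (odd u) s t
coLt⇒Lt u [] [] ()
coLt⇒Lt u (x ∷ xs) (.x ∷ ys) (inj₁ (refl , l)) =
  inj₁ (refl , subst (λ q → Lt q xs ys) (odd-+wt u x) (coLt⇒Lt (u + wt x) xs ys l))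
coLt⇒Lt u (x ∷ xs) (y ∷ ys) (inj₂ (_ , inj₁ (u%2≡0 , x<y))) with odd u | odd-%2 u
... | false | _ = inj₂ x<y
... | true  | eq = contradiction (trans (sym u%2≡0) eq) λ ()
coLt⇒Lt u (x ∷ xs) (y ∷ ys) (inj₂ (_ , inj₂ (u%2≡1 , y<x))) with odd u | odd-%2 u
... | true  | _ = inj₂ y<x
... | false | eq = contradiction (trans (sym u%2≡1) eq) λ ()

Lt-irrefl : ∀ p {ℓ} (s : Vec ℕ ℓ) → ¬ Lt p s s
Lt-irrefl p (x ∷ xs) (inj₁ (_ , l)) = Lt-irrefl (p xor flip x) xs l
Lt-irrefl false (x ∷ xs) (inj₂ x<x) = <-irrefl refl x<x
Lt-irrefl true (x ∷ xs) (inj₂ x<x) = <-irrefl refl x<x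

Lt-trans : ∀ p {ℓ} (s t u : Vec ℕ ℓ) → Lt p s t → Lt p t u → Lt p s u
Lt-trans p [] [] [] ()
Lt-trans p (x ∷ xs) (.x ∷ ys) (.x ∷ zs) (inj₁ (refl , l)) (inj₁ (refl , l′)) =
  inj₁ (refl , Lt-trans (p xor flip x) xs ys zs l l′)
Lt-trans p (x ∷ xs) (.x ∷ ys) (z ∷ zs) (inj₁ (refl , _)) (inj₂ d) = inj₂ d
Lt-trans p (x ∷ xs) (y ∷ ys) (.y ∷ zs) (inj₂ d) (inj₁ (refl , _)) = inj₂ d
Lt-trans false (x ∷ xs) (y ∷ ys) (z ∷ zs) (inj₂ x<y) (inj₂ y<z) = inj₂ (<-trans x<y y<z)
Lt-trans true (x ∷ xs) (y ∷ ys) (z ∷ zs) (inj₂ y<x) (inj₂ z<y) = inj₂ (<-trans z<y y<x)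

-- Reversing the direction reverses the order; this turns facts about least elements
-- into facts about greatest ones.
Lt-reverse : ∀ p {ℓ} (s t : Vec ℕ ℓ) → Lt p s t → Lt (not p) t s
Lt-reverse p [] [] ()
Lt-reverse p (x ∷ xs) (.x ∷ ys) (inj₁ (refl , l)) =
  inj₁ (refl , subst (λ q → Lt q ys xs) (not-distribˡ-xor p (flip x)) (Lt-reverse (p xor flip x) xs ys l))
Lt-reverse false (x ∷ xs) (y ∷ ys) (inj₂ x<y) = inj₂ x<y
Lt-reverse true (x ∷ xs) (y ∷ ys) (inj₂ y<x) = inj₂ y<x

data Head : ℕ → ∀ {ℓ} → Vec ℕ ℓ → Vec ℕ ℓ → Set where
  same : ∀ {d ℓ} {xs : Vec ℕ ℓ} → Head d xs xs
  diff : ∀ {d ℓ x y} {xs ys : Vec ℕ ℓ} → x ≢ y → Head d xs ys → Head (suc d) (x ∷ xs) (y ∷ ys)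

data Block (d : ℕ) : ∀ {ℓ} → Vec ℕ ℓ → Vec ℕ ℓ → Set where
  skip : ∀ {ℓ x} {xs ys : Vec ℕ ℓ} → Block d xs ys → Block d (x ∷ xs) (x ∷ ys)
  at   : ∀ {ℓ} {xs ys : Vec ℕ ℓ} → Head d xs ys → Block d xs ys

Head-sym : ∀ {d ℓ} {xs ys : Vec ℕ ℓ} → Head d xs ys → Head d ys xs
Head-sym same = same
Head-sym (diff x≢y h) = diff (≢-sym x≢y) (Head-sym h)

hamming-refl : ∀ {ℓ} (xs : Vec ℕ ℓ) → hamming xs xs ≡ 0
hamming-refl [] = refl
hamming-refl (x ∷ xs) with x ≟ x
... | yes _ = hamming-refl xs
... | no x≢x = contradiction refl x≢x

hamming-Head : ∀ {d ℓ} {xs ys : Vec ℕ ℓ} → Head d xs ys → hamming xs ys ≤ d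
hamming-Head {xs = xs} same = ≤-trans (≤-reflexive (hamming-refl xs)) z≤n
hamming-Head {xs = x ∷ _} {y ∷ _} (diff x≢y h) with x ≟ y
... | yes x≡y = contradiction x≡y x≢y
... | no _ = s≤s (hamming-Head h)

Differ : ∀ {ℓ} → Vec ℕ ℓ → Vec ℕ ℓ → Fin ℓ → Set
Differ xs ys i = lookup xs i ≢ lookup ys i

Head-down : ∀ {d ℓ} {xs ys : Vec ℕ ℓ} → Head d xs ys →
  (j k : Fin ℓ) → toℕ j ≤ toℕ k → Differ xs ys k → Differ xs ys j
Head-down same j k _ d = contradiction refl d
Head-down (diff x≢y h) fzero k _ _ = x≢y
Head-down (diff x≢y h) (fsuc j) (fsuc k) j≤k d = Head-down h j k (s≤s⁻¹ j≤k) d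

Block⇒AdjGrayStep : ∀ {d ℓ} {s t : Vec ℕ ℓ} → Block d s t → AdjGrayStep d s t
Block⇒AdjGrayStep b = hamming-Block b , adjacent b
  where
    hamming-Block : ∀ {d ℓ} {s t : Vec ℕ ℓ} → Block d s t → hamming s t ≤ d
    hamming-Block {s = x ∷ _} (skip b) with x ≟ x
    ... | yes _ = hamming-Block b
    ... | no x≢x = contradiction refl x≢x
    hamming-Block (at h) = hamming-Head h

    adjacent : ∀ {d ℓ} {s t : Vec ℕ ℓ} → Block d s t → DiffAdjacent s t
    adjacent (skip b) fzero j k _ _ d₀ _ = contradiction refl d₀
    adjacent (skip b) (fsuc i) (fsuc j) (fsuc k) i≤j j≤k dᵢ dₖ = adjacent b i j k (s≤s⁻¹ i≤j) (s≤s⁻¹ j≤k) dᵢ dₖ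
    adjacent (at h) i j k _ j≤k _ dₖ = Head-down h j k j≤k dₖ

GapFree : {A : Set} → (A → A → Set) → List A → A → A → Set
GapFree _<_ L s t = ∀ {r} → r ∈ L → s < r → ¬ r < t

linked-gapFree : {A : Set} {_<_ P : A → A → Set} →
  (∀ {x y z} → x < y → y < z → x < z) → (∀ {x} → ¬ x < x) →
  (L : List A) → AllPairs _<_ L →
  (∀ {s t} → s ∈ L → t ∈ L → s < t → GapFree _<_ L s t → P s t) → Linked P L
linked-gapFree <-trans′ <-irrefl′ [] _ _ = []
linked-gapFree <-trans′ <-irrefl′ (x ∷ []) _ _ = [-]
linked-gapFree {_<_ = _<_} {P} <-trans′ <-irrefl′ (x ∷ y ∷ L) (x<yL@(x<y ∷ _) ∷ sorted@(y<L ∷ _)) h =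
  h (here refl) (there (here refl)) x<y between-x-y ∷ linked-gapFree <-trans′ <-irrefl′ (y ∷ L) sorted h′
  where
    between-x-y : GapFree _<_ (x ∷ y ∷ L) x y
    between-x-y (here refl) x<x _ = <-irrefl′ x<x
    between-x-y (there (here refl)) _ y<y = <-irrefl′ y<y
    between-x-y (there (there r∈L)) _ r<y = <-irrefl′ (<-trans′ (All.lookup y<L r∈L) r<y)

    h′ : ∀ {s t} → s ∈ y ∷ L → t ∈ y ∷ L → s < t → GapFree _<_ (y ∷ L) s t → P s t
    h′ {s} {t} s∈ t∈ s<t gap = h (there s∈) (there t∈) s<t gap′
      where
        gap′ : GapFree _<_ (x ∷ y ∷ L) s t
        gap′ (here refl) s<x _ = <-irrefl′ (<-trans′ (All.lookup x<yL s∈) s<x)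
        gap′ (there r∈) = gap r∈

module Tails (c : ℕ) (c-odd : odd c ≡ true) where

  b : ℕ
  b = suc c

  -- Valid m s: s may follow a prefix with maximum m inside a member of R_n(b).
  Valid : ℕ → ∀ {ℓ} → Vec ℕ ℓ → Set
  Valid m s = RGTail m s × BoundedBy b s

  valid-∷ : ∀ {m x ℓ} {xs : Vec ℕ ℓ} → x ≤ suc m → x ≤ b → Valid (m ⊔ x) xs → Valid m (x ∷ xs)
  valid-∷ x≤m x≤b (rg , bd) = (x≤m , rg) , (x≤b , bd)

  valid-tail : ∀ {m x ℓ} {xs : Vec ℕ ℓ} → Valid m (x ∷ xs) → Valid (m ⊔ x) xs
  valid-tail ((_ , rg) , (_ , bd)) = rg , bd

  -- The largest entry allowed after a prefix with maximum m, namely min (m + 1) b.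
  cap : ℕ → ℕ
  cap m = suc (m ⊓ c)

  zeros : ∀ ℓ → Vec ℕ ℓ
  zeros ℓ = replicate ℓ 0

  least : ℕ → Bool → (ℓ : ℕ) → Vec ℕ ℓ
  least m false ℓ = zeros ℓ
  least m true zero = []
  least m true (suc ℓ) = cap m ∷ least (m ⊔ cap m) (not (flip (cap m))) ℓ

  greatest : ℕ → Bool → (ℓ : ℕ) → Vec ℕ ℓ
  greatest m p = least m (not p)

  zeros-valid : ∀ m ℓ → Valid m (zeros ℓ)
  zeros-valid m zero = tt , tt
  zeros-valid m (suc ℓ) = valid-∷ z≤n z≤n (zeros-valid (m ⊔ 0) ℓ)

  least-valid : ∀ m p ℓ → Valid m (least m p ℓ)
  least-valid m false ℓ = zeros-valid m ℓ
  least-valid m true zero = tt , tt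
  least-valid m true (suc ℓ) =
    valid-∷ (s≤s (m⊓n≤m m c)) (s≤s (m⊓n≤n m c)) (least-valid (m ⊔ cap m) (not (flip (cap m))) ℓ)

  least-min : ∀ m p ℓ (t : Vec ℕ ℓ) → Valid m t → Le p (least m p ℓ) t
  least-min m false zero [] _ = inj₁ refl
  least-min m false (suc ℓ) (zero ∷ t) vt = Le-cons {p = false} (least-min (m ⊔ 0) false ℓ t (valid-tail vt))
  least-min m false (suc ℓ) (suc y ∷ t) _ = inj₂ (inj₂ (s≤s z≤n))
  least-min m true zero [] _ = inj₁ refl
  least-min m true (suc ℓ) (y ∷ t) vt@((y≤m , _) , (y≤b , _)) with y ≟ cap m
  ... | yes refl = Le-cons {p = true} (least-min (m ⊔ cap m) (not (flip (cap m))) ℓ t (valid-tail vt))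
  ... | no y≢cap = inj₂ (inj₂ (≤∧≢⇒< (⊓-glb y≤m y≤b) y≢cap))

  greatest-max : ∀ m p ℓ (t : Vec ℕ ℓ) → Valid m t → Le p t (greatest m p ℓ)
  greatest-max m p ℓ t vt with least-min m (not p) ℓ t vt
  ... | inj₁ eq = inj₁ (sym eq)
  ... | inj₂ l = inj₂ (subst (λ q → Lt q t (greatest m p ℓ)) (not-involutive p) (Lt-reverse (not p) _ t l))

  greatest-maximal : ∀ m p ℓ (t : Vec ℕ ℓ) → Valid m t → ¬ Lt p (greatest m p ℓ) t
  greatest-maximal m p ℓ t vt G<t with greatest-max m p ℓ t vt
  ... | inj₁ refl = Lt-irrefl p t G<t
  ... | inj₂ t<G = Lt-irrefl p t (Lt-trans p t _ t t<G G<t)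

  -- Shape of the descending-least tail least m true: since b is even, it is nonzero in at
  -- most its first two entries, namely cap m, or (m + 1, m + 2) when m + 1 is odd.

  top-even : ∀ m ℓ → flip (cap m) ≡ true → least m true (suc ℓ) ≡ cap m ∷ zeros ℓ
  top-even m ℓ cap-even rewrite cap-even = refl

  -- An odd cap is m + 1 < b, because b is even.
  cap-odd⇒below : ∀ m → flip (cap m) ≡ false → m < c
  cap-odd⇒below m cap-odd with c ≤? m
  ... | yes c≤m = contradiction (trans (sym c-odd) (trans (cong odd (sym (m≥n⇒m⊓n≡n c≤m))) cap-odd)) λ ()
  ... | no c≰m = ≰⇒> c≰m

  cap-below : ∀ {m} → m ≤ c → cap m ≡ suc m
  cap-below m≤c = cong suc (m≤n⇒m⊓n≡m m≤c)

  top-tail : ∀ m ℓ → Head 1 (least (m ⊔ cap m) (not (flip (cap m))) ℓ) (zeros ℓ)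
  top-tail m ℓ with odd (m ⊓ c) in cap-parity
  ... | true = same
  ... | false = subst (λ k → Head 1 (least k true ℓ) (zeros ℓ)) (sym prefix-max) (next-top ℓ)
    where
      m<c : m < c
      m<c = cap-odd⇒below m cap-parity

      prefix-max : m ⊔ cap m ≡ suc m
      prefix-max = trans (cong (m ⊔_) (cap-below (<⇒≤ m<c))) (m≤n⇒m⊔n≡n (n≤1+n m))

      m-even : odd m ≡ false
      m-even = trans (cong odd (sym (m≤n⇒m⊓n≡m (<⇒≤ m<c)))) cap-parity

      next-cap-even : flip (cap (suc m)) ≡ true
      next-cap-even = trans (cong flip (cap-below m<c)) (cong not m-even)

      next-top : ∀ ℓ → Head 1 (least (suc m) true ℓ) (zeros ℓ)
      next-top zero = same
      next-top (suc ℓ) = subst (λ v → Head 1 v (zeros (suc ℓ))) (sym (top-even (suc m) ℓ next-cap-even)) (diff (λ ()) same)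

  top-zeros : ∀ m ℓ → Head 2 (least m true ℓ) (zeros ℓ)
  top-zeros m zero = same
  top-zeros m (suc ℓ) = diff (λ ()) (top-tail m ℓ)

  top-at-b : ∀ m ℓ → c ≤ m → least m true (suc ℓ) ≡ b ∷ zeros ℓ
  top-at-b m ℓ c≤m =
    trans (top-even m ℓ (trans (cong odd (m≥n⇒m⊓n≡n c≤m)) c-odd)) (cong (λ v → suc v ∷ zeros ℓ) (m≥n⇒m⊓n≡n c≤m))

  top-step : ∀ m ℓ → odd m ≡ true → m ≤ c → Head 2 (least m true ℓ) (least (suc m) true ℓ)
  top-step m zero _ _ = same
  top-step m (suc ℓ) m-odd m≤c with m≤n⇒m<n∨m≡n m≤c
  ... | inj₂ refl rewrite top-at-b m ℓ ≤-refl | top-at-b (suc m) ℓ (n≤1+n m) = same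
  ... | inj₁ m<c = subst (λ v → Head 2 v (least (suc m) true (suc ℓ))) (sym top-m)
                     (diff (λ eq → 1+n≢n (sym (suc-injective (trans eq (cap-below m<c))))) (Head-sym (top-tail (suc m) ℓ)))
    where
      top-m : least m true (suc ℓ) ≡ suc m ∷ zeros ℓ
      top-m = trans (top-even m ℓ (trans (cong odd (m≤n⇒m⊓n≡m m≤c)) m-odd)) (cong (_∷ zeros ℓ) (cap-below m≤c))

  top-raise : ∀ m x ℓ → x ≤ m → x ≤ c → odd x ≡ true →
    Head 2 (least (m ⊔ x) true ℓ) (least (m ⊔ suc x) true ℓ)
  top-raise m x ℓ x≤m x≤c x-odd with m≤n⇒m<n∨m≡n x≤m
  ... | inj₁ x<m rewrite m≥n⇒m⊔n≡m x≤m | m≥n⇒m⊔n≡m x<m = same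
  ... | inj₂ refl rewrite ⊔-idem x | m≤n⇒m⊔n≡n (n≤1+n x) = top-step x ℓ x-odd x≤c

  -- This is where the evenness of b makes the code 3-adjacent.
  boundary : ∀ m x ℓ → x ≤ m → x ≤ c →
    Head 2 (greatest (m ⊔ x) (flip x) ℓ) (least (m ⊔ suc x) (flip (suc x)) ℓ)
  boundary m zero ℓ _ _ = top-zeros (m ⊔ 0) ℓ
  boundary m (suc x) ℓ x≤m x≤c with odd x in x-parity
  ... | true = same
  ... | false = top-raise m (suc x) ℓ x≤m x≤c (cong not x-parity)

  next : Bool → ℕ → ℕ
  next false x = suc x
  next true x = pred x

  Dir⇒≢ : ∀ p {x y} → Dir p x y → x ≢ y
  Dir⇒≢ false x<y refl = <-irrefl refl x<y
  Dir⇒≢ true y<x refl = <-irrefl refl y<x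

  dir-next : ∀ p {x y} → Dir p x y → Dir p x (next p x)
  dir-next false {x} _ = n<1+n x
  dir-next true {suc x} _ = n<1+n x

  dir-cover : ∀ p {x y} → Dir p x y → next p x ≡ y ⊎ Dir p (next p x) y
  dir-cover false x<y with m≤n⇒m<n∨m≡n x<y
  ... | inj₁ x+1<y = inj₂ x+1<y
  ... | inj₂ x+1≡y = inj₁ x+1≡y
  dir-cover true {suc x} y<x+1 with m≤n⇒m<n∨m≡n (s≤s⁻¹ y<x+1)
  ... | inj₁ y<x = inj₂ y<x
  ... | inj₂ y≡x = inj₁ (sym y≡x)

  next-allowed : ∀ p {m x y} → Dir p x y → x ≤ suc m → x ≤ b → y ≤ suc m → y ≤ b →
    next p x ≤ suc m × next p x ≤ b
  next-allowed false x<y _ _ y≤m y≤b = ≤-trans x<y y≤m , ≤-trans x<y y≤b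
  next-allowed true {x = suc x} _ x≤m x≤b _ _ = ≤-trans (n≤1+n x) x≤m , ≤-trans (n≤1+n x) x≤b

  crossing-tails : ∀ p {m x y} ℓ → Dir p x y → x ≤ suc m → x ≤ b → y ≤ suc m → y ≤ b →
    Head 2 (greatest (m ⊔ x) (p xor flip x) ℓ) (least (m ⊔ next p x) (p xor flip (next p x)) ℓ)
  crossing-tails false {m} {x} ℓ x<y _ _ y≤m y≤b =
    boundary m x ℓ (s≤s⁻¹ (≤-trans x<y y≤m)) (s≤s⁻¹ (≤-trans x<y y≤b))
  crossing-tails true {m} {suc x} ℓ _ x≤m x≤b _ _ =
    subst (λ q → Head 2 (least (m ⊔ suc x) q ℓ) (greatest (m ⊔ x) (flip x) ℓ))
          (sym (not-involutive (flip (suc x))))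
          (Head-sym (boundary m x ℓ (s≤s⁻¹ x≤m) (s≤s⁻¹ x≤b)))

  record Successor (m : ℕ) (p : Bool) {ℓ} (s : Vec ℕ ℓ) : Set where
    field
      succ    : Vec ℕ ℓ
      valid   : Valid m succ
      above   : Lt p s succ
      near    : Block 3 s succ
      minimal : ∀ t → Valid m t → Lt p s t → Le p succ t

  extend : ∀ m p {x ℓ} {s : Vec ℕ ℓ} → x ≤ suc m → x ≤ b →
    Successor (m ⊔ x) (p xor flip x) s → Successor m p (x ∷ s)
  extend m p {x} x≤m x≤b r = record
    { succ = x ∷ succ
    ; valid = valid-∷ x≤m x≤b valid
    ; above = inj₁ (refl , above)
    ; near = skip near
    ; minimal = minimal′
    }
    where
      open Successor r
      minimal′ : ∀ t → Valid m t → Lt p (x ∷ _) t → Le p (x ∷ succ) t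
      minimal′ (.x ∷ t) vt (inj₁ (refl , l)) = Le-cons {p = p} (minimal t (valid-tail vt) l)
      minimal′ (y ∷ t) _ (inj₂ d) = inj₂ (inj₂ d)

  cross : ∀ m p {x y} ℓ → Dir p x y → x ≤ suc m → x ≤ b → y ≤ suc m → y ≤ b →
    Successor m p (x ∷ greatest (m ⊔ x) (p xor flip x) ℓ)
  cross m p {x} ℓ d x≤m x≤b y≤m y≤b = record
    { succ = x′ ∷ least (m ⊔ x′) (p xor flip x′) ℓ
    ; valid = valid-∷ x′≤m x′≤b (least-valid (m ⊔ x′) (p xor flip x′) ℓ)
    ; above = inj₂ (dir-next p d)
    ; near = at (diff (Dir⇒≢ p (dir-next p d)) (crossing-tails p ℓ d x≤m x≤b y≤m y≤b))
    ; minimal = minimal′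
    }
    where
      x′ = next p x
      x′≤m = proj₁ (next-allowed p d x≤m x≤b y≤m y≤b)
      x′≤b = proj₂ (next-allowed p d x≤m x≤b y≤m y≤b)

      minimal′ : ∀ t → Valid m t → Lt p (x ∷ greatest (m ⊔ x) (p xor flip x) ℓ) t →
        Le p (x′ ∷ least (m ⊔ x′) (p xor flip x′) ℓ) t
      minimal′ (.x ∷ t) vt (inj₁ (refl , G<t)) =
        ⊥-elim (greatest-maximal (m ⊔ x) (p xor flip x) ℓ t (valid-tail vt) G<t)
      minimal′ (z ∷ t) vt (inj₂ x→z) with dir-cover p x→z
      ... | inj₁ refl = Le-cons {p = p} (least-min (m ⊔ x′) (p xor flip x′) ℓ t (valid-tail vt))
      ... | inj₂ x′→z = inj₂ (inj₂ x′→z)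

  successor : ∀ m p {ℓ} (s t : Vec ℕ ℓ) → Valid m s → Valid m t → Lt p s t → Successor m p s
  successor m p [] [] _ _ ()
  successor m p {suc ℓ} (x ∷ s) (y ∷ t) vs@((x≤m , _) , (x≤b , _)) vt@((y≤m , _) , (y≤b , _)) s<t
    with greatest-max (m ⊔ x) (p xor flip x) ℓ s (valid-tail vs)
  ... | inj₂ s<G = extend m p x≤m x≤b
    (successor (m ⊔ x) (p xor flip x) s _ (valid-tail vs) (least-valid (m ⊔ x) (not (p xor flip x)) ℓ) s<G)
  ... | inj₁ refl with s<t
  ...   | inj₁ (refl , G<t) = ⊥-elim (greatest-maximal (m ⊔ x) (p xor flip x) ℓ t (valid-tail vt) G<t)
  ...   | inj₂ x→y = cross m p ℓ x→y x≤m x≤b y≤m y≤b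

  -- Members of R_{ℓ+1}(b) are 0 ∷ s with s valid after prefix maximum 0, so a member below
  -- another one has an immediate successor in R_{ℓ+1}(b) reached by a Block 3 step.
  rgf-successor : ∀ {ℓ} (s t : Vec ℕ (suc ℓ)) → InR (suc ℓ) b s → InR (suc ℓ) b t → Lt false s t →
    Σ[ r ∈ Vec ℕ (suc ℓ) ] InR (suc ℓ) b r × Lt false s r × Block 3 s r × Le false r t
  rgf-successor (.0 ∷ s) (.0 ∷ t) ((refl , rs) , (_ , bs)) ((refl , rt) , (_ , bt)) (inj₁ (_ , s<t)) =
    0 ∷ succ , ((refl , proj₁ valid) , (z≤n , proj₂ valid)) , inj₁ (refl , above) , skip near ,
    Le-cons {p = false} (minimal t (rt , bt) s<t)
    where open Successor (successor 0 false s t (rs , bs) (rt , bt) s<t)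

odd-double : ∀ q → odd (q * 2) ≡ false
odd-double zero = refl
odd-double (suc q) = trans (not-involutive (odd (q * 2))) (odd-double q)

theorem2 : (n b : ℕ) → 1 ≤ n → 2 ≤ b → 2 ∣ b →
    (L : List (Vec ℕ n)) →
    Linked _⋖_ L →
    ((s : Vec ℕ n) → (s ∈ L → InR n b s) × (InR n b s → s ∈ L)) →
    Linked (AdjGrayStep 3) L
theorem2 (suc n) (suc (suc c)) _ _ (divides q b≡2q) L sorted members =
  linked-gapFree (λ {s t u} → Lt-trans false s t u) (λ {s} → Lt-irrefl false s) L
    (Linked⇒AllPairs (λ {s t u} → Lt-trans false s t u) (LinkedP.map (λ {s t} → coLt⇒Lt 0 s t) sorted))
    gray-step
  where
    c-odd : odd (suc c) ≡ true
    c-odd = trans (sym (not-involutive (odd (suc c)))) (cong not (trans (cong odd b≡2q) (odd-double q)))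

    open Tails (suc c) c-odd

    -- For consecutive members s, t of L, the immediate successor r of s lies in L with r ≤ t;
    -- as no member of L lies strictly between s and t, r = t.
    gray-step : ∀ {s t} → s ∈ L → t ∈ L → Lt false s t → GapFree (Lt false) L s t → AdjGrayStep 3 s t
    gray-step {s} {t} s∈L t∈L s<t gap
      with rgf-successor s t (proj₁ (members s) s∈L) (proj₁ (members t) t∈L) s<t
    ... | r , r∈R , s<r , near , inj₁ refl = Block⇒AdjGrayStep near
    ... | r , r∈R , s<r , near , inj₂ r<t = ⊥-elim (gap (proj₂ (members r) r∈R) s<r r<t)
theorem2 zero _ () _ _ _ _ _
theorem2 (suc n) zero _ () _ _ _ _
theorem2 (suc n) (suc zero) _ (s≤s ()) _ _ _ _
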